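{- For any numerical semigroup $\Lambda$ and any integer $g \ge 0$, we have $N_g(\Lambda) \le \binom{h(\Lambda)}{g - g(\Lambda)}$ and $N_g(\Lambda) \le \varphi^{g - g(\Lambda) + h(\Lambda)}$, where $\varphi = \frac{1+\sqrt5}{2}$ (and $\binom{a}{b}=0$ for $b<0$).
   Context: A numerical semigroup is a subset $\Lambda \subseteq \mathbb{N}$ containing $0$, closed under addition, with finite complement. Genus $g(\Lambda) = |\mathbb{N}\setminus\Lambda|$; Frobenius number $f(\Lambda) = \max(\mathbb{N}\setminus\Lambda)$ (with $f(\mathbb{N})=-1$). A minimal generator of $\Lambda$ is a nonzero element of $\Lambda$ not expressible as a sum of two nonzero elements of $\Lambda$. An effective generator is a minimal generator larger than $f(\Lambda)$; $h(\Lambda)$ is the number of effective generators. A semigroup $\Lambda'$ descends from $\Lambda$ if $\Lambda' = \Lambda \setminus \{\lambda\}$ for an effective generator $\lambda$ of $\Lambda$; this descent is weak if every effective generator of $\Lambda'$ is also an effective generator of $\Lambda$. $\Lambda''$ is a weak descendent of $\Lambda$ if it is obtained from $\Lambda$ by a finite (possibly empty) sequence of weak descents. $N_g(\Lambda)$ is the number of weak descendents of $\Lambda$ of genus $g$. -}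

module Defs where

open import Data.Nat using (ℕ; zero; suc; _+_; _≤_; _<_)
open import Data.Nat.Combinatorics using (_C_)
open import Data.Integer as ℤ using (ℤ; +_; -[1+_]; 0ℤ; 1ℤ)
open import Data.Bool using (Bool; true; false)
open import Data.Product using (Σ; ∃; ∃-syntax; _×_; _,_)
open import Data.Sum using (_⊎_)
open import Data.List using (List; length)
open import Data.List.Membership.Propositional using (_∈_)
open import Data.List.Relation.Unary.Unique.Propositional using (Unique)
open import Data.List.Relation.Unary.All using (All)
open import Data.List.Relation.Unary.AllPairs using (AllPairs)
open import Relation.Binary.PropositionalEquality using (_≡_; _≢_)
open import Relation.Nullary using (¬_)
open import Function.Bundles using (_⇔_)

Subℕ : Set
Subℕ = ℕ → Bool

_∈ₛ_ : ℕ → Subℕ → Set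
n ∈ₛ S = S n ≡ true

_≐_ : Subℕ → Subℕ → Set
S ≐ T = ∀ n → S n ≡ T n

record IsNumericalSemigroup (S : Subℕ) : Set where
  field
    zero∈   : 0 ∈ₛ S
    +-closed : ∀ a b → a ∈ₛ S → b ∈ₛ S → (a + b) ∈ₛ S
    cofinite : ∃[ c ] (∀ n → c ≤ n → n ∈ₛ S)

HasCard : (ℕ → Set) → ℕ → Set
HasCard P k = ∃[ xs ] (Unique xs × (∀ n → (n ∈ xs) ⇔ P n) × length xs ≡ k)

Gap : Subℕ → ℕ → Set
Gap S n = ¬ (n ∈ₛ S)

Genus : Subℕ → ℕ → Set
Genus S k = HasCard (Gap S) k

-- λ > f(S), f(S) = max of the gaps (f(ℕ) = -1): λ exceeds every gap
AboveFrobenius : Subℕ → ℕ → Set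
AboveFrobenius S l = ∀ n → Gap S n → n < l

MinimalGenerator : Subℕ → ℕ → Set
MinimalGenerator S l =
  l ∈ₛ S × l ≢ 0 ×
  ¬ (∃[ a ] ∃[ b ] (a ∈ₛ S × b ∈ₛ S × a ≢ 0 × b ≢ 0 × a + b ≡ l))

EffectiveGenerator : Subℕ → ℕ → Set
EffectiveGenerator S l = MinimalGenerator S l × AboveFrobenius S l

-- h(S) = k  is  HasCard (EffectiveGenerator S) k
Remove : Subℕ → ℕ → Subℕ
Remove S l n with n Data.Nat.≟ l
... | Relation.Nullary.yes _ = false
... | Relation.Nullary.no _  = S n

WeakDescent : Subℕ → Subℕ → Set
WeakDescent S T =
  ∃[ l ] (EffectiveGenerator S l × T ≐ Remove S l ×
          (∀ m → EffectiveGenerator T m → EffectiveGenerator S m))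

data WeakDescendent (S : Subℕ) : Subℕ → Set where
  here : ∀ {T} → T ≐ S → WeakDescendent S T
  step : ∀ {T U} → WeakDescendent S T → WeakDescent T U → WeakDescendent S U

binomℤ : ℕ → ℤ → ℕ
binomℤ a (+ b)    = a C b
binomℤ a -[1+ _ ] = 0

-- Exact arithmetic in ℤ[φ], φ = (1+√5)/2 (φ² = φ + 1).
-- ⟨ a , b ⟩ stands for the real number a + b·φ.
record ℤφ : Set where
  constructor ⟨_,_⟩
  field
    re : ℤ
    ph : ℤ

_*φ_ : ℤφ → ℤφ → ℤφ
⟨ a , b ⟩ *φ ⟨ c , d ⟩ = ⟨ a ℤ.* c ℤ.+ b ℤ.* d , a ℤ.* d ℤ.+ b ℤ.* c ℤ.+ b ℤ.* d ⟩

_-φ_ : ℤφ → ℤφ → ℤφ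
⟨ a , b ⟩ -φ ⟨ c , d ⟩ = ⟨ a ℤ.- c , b ℤ.- d ⟩

φ : ℤφ
φ = ⟨ 0ℤ , 1ℤ ⟩

φ⁻¹ : ℤφ          -- 1/φ = φ - 1
φ⁻¹ = ⟨ ℤ.-[1+ 0 ] , 1ℤ ⟩

powℕ : ℤφ → ℕ → ℤφ
powℕ x zero    = ⟨ 1ℤ , 0ℤ ⟩
powℕ x (suc n) = x *φ powℕ x n

φ^ : ℤ → ℤφ
φ^ (+ n)     = powℕ φ n
φ^ -[1+ n ]  = powℕ φ⁻¹ (suc n)

-- the real number a + b·φ is ≥ 0  (exact sign test, using φ > 0, φ² = φ + 1)
NonNeg : ℤφ → Set
NonNeg ⟨ a , b ⟩ =
    (0ℤ ℤ.≤ a × 0ℤ ℤ.≤ b)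
  ⊎ (0ℤ ℤ.≤ a × b ℤ.< 0ℤ × b ℤ.* b ℤ.≤ a ℤ.* a ℤ.+ a ℤ.* b)
  ⊎ (a ℤ.< 0ℤ × 0ℤ ℤ.< b × a ℤ.* a ℤ.≤ b ℤ.* b ℤ.- a ℤ.* b)

_≤φ_ : ℤφ → ℤφ → Set
x ≤φ y = NonNeg (y -φ x)

ℕ→ℤφ : ℕ → ℤφ
ℕ→ℤφ n = ⟨ + n , 0ℤ ⟩

-- "N_g(S) ≤ B": every list of pairwise distinct weak descendents of S
-- of genus g has length ≤ B  (B given as a predicate on the length).
DistinctWeakDescendentsOfGenus : Subℕ → ℕ → List Subℕ → Set
DistinctWeakDescendentsOfGenus S g Ts =
  All (λ T → WeakDescendent S T × Genus T g) Ts ×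
  AllPairs (λ T U → ¬ (T ≐ U)) Ts

module Submission where

-- Every weak descendent T of S is S with a set X of effective generators of S removed:
-- weakness means the effective generators of T are among those of S, so each further
-- descent removes one more of them. Hence g(T) = g(S) + |X| and T is determined by X,
-- which is a (g(T) - g(S))-subset of the h(S) effective generators; this gives the
-- binomial bound. For the second bound, binom(h, k) ≤ F(h + k + 1) ≤ φ^(h + k) by
-- Pascal's rule and the Fibonacci recursion, and φⁿ = F(n - 1) + F(n)·φ is compared
-- with an integer exactly in ℤ[φ]. For g < g(S) there are no descendents, and the
-- bound reduces to nonnegativity of φ^e for negative e, i.e. stability of
-- nonnegativity under division by φ.

open import Defs
open import Data.Nat as ℕ using (ℕ; zero; suc; z≤n; s≤s; _≤_; _∸_; _≤?_)
import Data.Nat.Properties as ℕₚ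
open import Data.Nat.Combinatorics using (_C_; nCk+nC[k+1]≡[n+1]C[k+1])
open import Data.Integer as ℤ using (+_; -[1+_]; 0ℤ; 1ℤ; -_; _⊖_; +≤+; -<+; +<+; _+_; _-_; _*_)
import Data.Integer.Properties as ℤₚ
open import Data.Integer.Tactic.RingSolver using (solve-∀)
open import Data.Bool as Bool using (Bool; true; false; _∧_; _∨_; not)
open import Data.Bool.Properties using (∧-identityʳ; ∧-zeroʳ; ∧-conicalˡ)
open import Data.List using (List; []; _∷_; length; map; filter; _++_)
open import Data.List.Properties using (length-map; length-++; length-removeAt′; ∷-injectiveˡ; ∷-injectiveʳ)
open import Data.List.Membership.Propositional using (_∈_; _∉_)
open import Data.List.Membership.DecPropositional ℕ._≟_ using (_∈?_)
open import Data.List.Membership.Propositional.Properties using (∈-filter⁺; ∈-filter⁻; ∈-++⁺ˡ; ∈-++⁺ʳ; ∈-++⁻)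
open import Data.List.Relation.Unary.All as All using (All; []; _∷_)
open import Data.List.Relation.Unary.AllPairs using (AllPairs; []; _∷_)
open import Data.List.Relation.Unary.Any using (here; there; index; _─_)
open import Data.List.Relation.Unary.Unique.Propositional using (Unique)
open import Data.List.Relation.Unary.Unique.Propositional.Properties using (++⁺; filter⁺)
open import Data.Product using (∃-syntax; _×_; _,_; proj₁; proj₂)
open import Data.Sum using (inj₁; inj₂)
open import Data.Empty using (⊥-elim)
open import Function using (_∘_; case_of_)
open import Function.Bundles using (_⇔_; mk⇔; Equivalence)
open import Relation.Binary.PropositionalEquality
open import Relation.Nullary using (yes; no; does; ¬_)
open import Relation.Nullary.Decidable using (dec-true; dec-false)
open import Relation.Unary using (Decidable)

open Equivalence using (to; from)

fib : ℕ → ℕ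
fib 0 = 0
fib 1 = 1
fib (suc (suc n)) = fib n ℕ.+ fib (suc n)

-- F(n - 1), with the convention F(-1) = 1
fibPrev : ℕ → ℕ
fibPrev zero    = 1
fibPrev (suc n) = fib n

fibPrev+fib : ∀ n → fibPrev n ℕ.+ fib n ≡ fib (suc n)
fibPrev+fib zero    = refl
fibPrev+fib (suc n) = refl

fib-pos : ∀ n → 1 ≤ fib (suc n)
fib-pos zero    = s≤s z≤n
fib-pos (suc n) = ℕₚ.≤-trans (fib-pos n) (ℕₚ.m≤n+m (fib (suc n)) (fib n))

C≤fib : ∀ h k → h C k ≤ fib (suc (k ℕ.+ h))
C≤fib zero    zero    = s≤s z≤n
C≤fib zero    (suc k) = z≤n
C≤fib (suc h) zero    = fib-pos (suc h)
C≤fib (suc h) (suc k) =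
  subst₂ _≤_ (nCk+nC[k+1]≡[n+1]C[k+1] h k) (cong (λ m → fib m ℕ.+ fib (suc m)) (sym (ℕₚ.+-suc k h)))
    (ℕₚ.+-mono-≤ (C≤fib h k) (C≤fib h (suc k)))

φ*φ : ∀ a b → φ *φ ⟨ a , b ⟩ ≡ ⟨ b , a + b ⟩
φ*φ a b = cong₂ ⟨_,_⟩ (re a b) (ph a b)
  where
  re : ∀ a b → 0ℤ * a + 1ℤ * b ≡ b
  re = solve-∀
  ph : ∀ a b → 0ℤ * b + 1ℤ * a + 1ℤ * b ≡ a + b
  ph = solve-∀

φ⁻¹*φ : ∀ a b → φ⁻¹ *φ ⟨ a , b ⟩ ≡ ⟨ b - a , a ⟩
φ⁻¹*φ a b = cong₂ ⟨_,_⟩ (re a b) (ph a b)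
  where
  re : ∀ a b → - 1ℤ * a + 1ℤ * b ≡ b - a
  re = solve-∀
  ph : ∀ a b → - 1ℤ * b + 1ℤ * a + 1ℤ * b ≡ a
  ph = solve-∀

φ-pow : ∀ n → powℕ φ n ≡ ⟨ + fibPrev n , + fib n ⟩
φ-pow zero    = refl
φ-pow (suc n) = begin
  φ *φ powℕ φ n                         ≡⟨ cong (φ *φ_) (φ-pow n) ⟩
  φ *φ ⟨ + fibPrev n , + fib n ⟩         ≡⟨ φ*φ (+ fibPrev n) (+ fib n) ⟩
  ⟨ + fib n , + (fibPrev n ℕ.+ fib n) ⟩  ≡⟨ cong (λ m → ⟨ + fib n , + m ⟩) (fibPrev+fib n) ⟩
  ⟨ + fib n , + fib (suc n) ⟩            ∎
  where open ≡-Reasoning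

≤-from-difference : ∀ {x y x′ y′} → x ℤ.≤ y → y′ - x′ ≡ y - x → x′ ℤ.≤ y′
≤-from-difference x≤y eq = ℤₚ.0≤i-j⇒j≤i (subst (0ℤ ℤ.≤_) (sym eq) (ℤₚ.i≤j⇒0≤j-i x≤y))

nonNeg-ℕ : ∀ a b → NonNeg ⟨ + a , + b ⟩
nonNeg-ℕ a b = inj₁ (+≤+ z≤n , +≤+ z≤n)

-- b·φ - d ≥ 0 because φ ≥ 1; in the encoding this is d² ≤ b² + d·b.
nonNeg-bφ-d : ∀ {d b} → d ≤ b → NonNeg ⟨ - + d , + b ⟩
nonNeg-bφ-d {zero}  {b} _  = nonNeg-ℕ 0 b
nonNeg-bφ-d {suc d} {b} sd≤b = inj₂ (inj₂ (-<+ , +<+ (ℕₚ.<-≤-trans (s≤s z≤n) sd≤b) , square-bound))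
  where
  e = suc d
  d²≤b²+db : e ℕ.* e ≤ b ℕ.* b ℕ.+ e ℕ.* b
  d²≤b²+db = ℕₚ.≤-trans (ℕₚ.*-monoʳ-≤ e sd≤b) (ℕₚ.m≤n+m (e ℕ.* b) (b ℕ.* b))
  lhs : ∀ x → x * x ≡ (- x) * (- x)
  lhs = solve-∀
  rhs : ∀ x y → y * y + x * y ≡ y * y - (- x) * y
  rhs = solve-∀
  square-bound : (- + e) * (- + e) ℤ.≤ + b * + b - (- + e) * + b
  square-bound = subst₂ ℤ._≤_
    (trans (ℤₚ.pos-* e e) (lhs (+ e)))
    (trans (ℤₚ.pos-+ (b ℕ.* b) (e ℕ.* b)) (trans (cong₂ ℤ._+_ (ℤₚ.pos-* b b) (ℤₚ.pos-* e b)) (rhs (+ e) (+ b))))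
    (+≤+ d²≤b²+db)

-- a - c + b·φ ≥ 0 because φ ≥ 1
nonNeg-⊖ : ∀ {a b c} → c ≤ a ℕ.+ b → NonNeg ⟨ a ⊖ c , + b ⟩
nonNeg-⊖ {a} {b} {c} c≤a+b with c ≤? a
... | yes c≤a rewrite ℤₚ.⊖-≥ c≤a = nonNeg-ℕ (a ∸ c) b
... | no  c≰a rewrite ℤₚ.⊖-≰ c≰a = nonNeg-bφ-d (ℕₚ.m≤n+o⇒m∸n≤o c a c≤a+b)

-- (a + b·φ)/φ = (b - a) + a·φ
nonNeg-/φ : ∀ {a b} → NonNeg ⟨ a , b ⟩ → NonNeg ⟨ b - a , a ⟩
nonNeg-/φ {+ p} {+ q} (inj₁ _) =
  subst (λ x → NonNeg ⟨ x , + p ⟩) (sym (ℤₚ.m-n≡m⊖n q p)) (nonNeg-⊖ (ℕₚ.m≤n+m p q))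
nonNeg-/φ {+ p}     {+ q}     (inj₂ (inj₁ (_ , +<+ () , _)))
nonNeg-/φ {+ zero}  { -[1+ s ] } (inj₂ (inj₁ (_ , _ , +≤+ ())))
nonNeg-/φ {+ suc p} { b@(-[1+ s ]) } (inj₂ (inj₁ (_ , b<0 , H))) =
  inj₂ (inj₂ (ℤₚ.≤-<-trans (ℤₚ.i-j≤i b (+ suc p)) b<0 , +<+ (s≤s z≤n) , ≤-from-difference H (shift (+ suc p) b)))
  where
  shift : ∀ a b → (a * a - (b - a) * a) - (b - a) * (b - a) ≡ (a * a + a * b) - b * b
  shift = solve-∀
nonNeg-/φ {a} {b} (inj₂ (inj₂ (a<0 , 0<b , H))) =
  inj₂ (inj₁ (ℤₚ.i≤j⇒0≤j-i (ℤₚ.<⇒≤ (ℤₚ.<-trans a<0 0<b)) , a<0 , ≤-from-difference H (shift a b)))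
  where
  shift : ∀ a b → ((b - a) * (b - a) + (b - a) * a) - a * a ≡ (b * b - a * b) - a * a
  shift = solve-∀

nonNeg-φ⁻¹-pow : ∀ n → NonNeg (powℕ φ⁻¹ n)
nonNeg-φ⁻¹-pow zero = nonNeg-ℕ 1 0
nonNeg-φ⁻¹-pow (suc n) with powℕ φ⁻¹ n | nonNeg-φ⁻¹-pow n
... | ⟨ a , b ⟩ | nn = subst NonNeg (sym (φ⁻¹*φ a b)) (nonNeg-/φ nn)

nonNeg-φ^ : ∀ e → NonNeg (φ^ e)
nonNeg-φ^ (+ n)     = subst NonNeg (sym (φ-pow n)) (nonNeg-ℕ (fibPrev n) (fib n))
nonNeg-φ^ -[1+ n ] = nonNeg-φ⁻¹-pow (suc n)

nonNeg⇒0≤φ : ∀ {x} → NonNeg x → ℕ→ℤφ 0 ≤φ x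
nonNeg⇒0≤φ {⟨ a , b ⟩} = subst₂ (λ u v → NonNeg ⟨ u , v ⟩) (sym (ℤₚ.+-identityʳ a)) (sym (ℤₚ.+-identityʳ b))

≤φ-pow : ∀ {c} n → c ≤ fib (suc n) → ℕ→ℤφ c ≤φ powℕ φ n
≤φ-pow {c} n c≤fib = subst (λ x → NonNeg (x -φ ℕ→ℤφ c)) (sym (φ-pow n))
  (subst₂ (λ u v → NonNeg ⟨ u , v ⟩) (sym (ℤₚ.m-n≡m⊖n (fibPrev n) c)) (sym (ℤₚ.+-identityʳ (+ fib n)))
    (nonNeg-⊖ (subst (c ≤_) (sym (fibPrev+fib n)) c≤fib)))

trues : List Bool → ℕ
trues []           = 0
trues (true ∷ bs)  = suc (trues bs)
trues (false ∷ bs) = trues bs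

HasWeight : ℕ → ℕ → List Bool → Set
HasWeight h k w = length w ≡ h × trues w ≡ k

tailsAfter : Bool → List (List Bool) → List (List Bool)
tailsAfter b []             = []
tailsAfter b ([] ∷ ws)      = tailsAfter b ws
tailsAfter b ((c ∷ w) ∷ ws) with b Bool.≟ c
... | yes _ = w ∷ tailsAfter b ws
... | no  _ = tailsAfter b ws

All-tailsAfter : ∀ {P : List Bool → Set} b {ws} → All P ws → All (λ w → P (b ∷ w)) (tailsAfter b ws)
All-tailsAfter b []                       = []
All-tailsAfter b {[] ∷ _}      (_ ∷ ps)   = All-tailsAfter b ps
All-tailsAfter b {(c ∷ _) ∷ _} (p ∷ ps) with b Bool.≟ c
... | yes refl = p ∷ All-tailsAfter b ps
... | no  _    = All-tailsAfter b ps

Unique-tailsAfter : ∀ b {ws} → Unique ws → Unique (tailsAfter b ws)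
Unique-tailsAfter b []                           = []
Unique-tailsAfter b {[] ∷ _}      (_ ∷ u)        = Unique-tailsAfter b u
Unique-tailsAfter b {(c ∷ _) ∷ _} (w∉ws ∷ u) with b Bool.≟ c
... | yes refl = All.map (λ w≢v w≡v → w≢v (cong (b ∷_) w≡v)) (All-tailsAfter b w∉ws) ∷ Unique-tailsAfter b u
... | no  _    = Unique-tailsAfter b u

length-tailsAfter : ∀ {h k ws} → All (HasWeight (suc h) k) ws →
                    length ws ≡ length (tailsAfter true ws) ℕ.+ length (tailsAfter false ws)
length-tailsAfter []                                 = refl
length-tailsAfter {ws = []           ∷ _} ((() , _) ∷ _)
length-tailsAfter {ws = (true  ∷ _) ∷ _} (_ ∷ ps)    = cong suc (length-tailsAfter ps)
length-tailsAfter {ws = (false ∷ _) ∷ _} (_ ∷ ps)    =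
  trans (cong suc (length-tailsAfter ps)) (sym (ℕₚ.+-suc _ _))

Unique-HasWeight-≤C : ∀ h k {ws} → All (HasWeight h k) ws → Unique ws → length ws ≤ h C k
Unique-HasWeight-≤C zero    k       {[]}          _                  _                 = z≤n
Unique-HasWeight-≤C zero    zero    {[] ∷ []}     _                  _                 = s≤s z≤n
Unique-HasWeight-≤C zero    zero    {[] ∷ [] ∷ _} _                  ((≢[] ∷ _) ∷ _)   = ⊥-elim (≢[] refl)
Unique-HasWeight-≤C zero    (suc k) {[] ∷ _}      ((_ , ()) ∷ _)     _
Unique-HasWeight-≤C zero    k       {(_ ∷ _) ∷ _} ((() , _) ∷ _)     _
Unique-HasWeight-≤C zero    k       {_ ∷ (_ ∷ _) ∷ _} (_ ∷ (() , _) ∷ _) _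
Unique-HasWeight-≤C (suc h) k       {ws}          weights            u                 = bound k weights
  where
  T = tailsAfter true ws
  F = tailsAfter false ws

  F-bound : ∀ {k} → All (HasWeight (suc h) k) ws → length F ≤ h C k
  F-bound {k} weights = Unique-HasWeight-≤C h k
    (All.map (λ { (refl , t) → refl , t }) (All-tailsAfter false weights)) (Unique-tailsAfter false u)

  no-true : ∀ {vs} → All (λ w → HasWeight (suc h) 0 (true ∷ w)) vs → length vs ≡ 0
  no-true [] = refl

  bound : ∀ k → All (HasWeight (suc h) k) ws → length ws ≤ suc h C k
  bound zero weights rewrite length-tailsAfter weights | no-true (All-tailsAfter true weights) = F-bound weights
  bound (suc k) weights rewrite length-tailsAfter weights =
    subst (length T ℕ.+ length F ≤_) (nCk+nC[k+1]≡[n+1]C[k+1] h k)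
      (ℕₚ.+-mono-≤ T-bound (F-bound weights))
    where
    T-bound : length T ≤ h C k
    T-bound = Unique-HasWeight-≤C h k
      (All.map (λ { (refl , refl) → refl , refl }) (All-tailsAfter true weights)) (Unique-tailsAfter true u)

∈-─ : ∀ {A : Set} {x y : A} {ys} (x∈ys : x ∈ ys) → y ∈ ys → y ≢ x → y ∈ (ys ─ x∈ys)
∈-─ (here refl) (here refl)  y≢x = ⊥-elim (y≢x refl)
∈-─ (here refl) (there y∈ys) _   = y∈ys
∈-─ (there _)   (here refl)  _   = here refl
∈-─ (there x∈ys) (there y∈ys) y≢x = there (∈-─ x∈ys y∈ys y≢x)

Unique-⊆⇒length-≤ : ∀ {A : Set} {xs ys : List A} → Unique xs → (∀ {y} → y ∈ xs → y ∈ ys) → length xs ≤ length ys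
Unique-⊆⇒length-≤ []                         _  = z≤n
Unique-⊆⇒length-≤ {xs = x ∷ xs} {ys} (x∉xs ∷ u) xs⊆ys =
  subst (suc (length xs) ≤_) (sym (length-removeAt′ ys (index x∈ys)))
    (s≤s (Unique-⊆⇒length-≤ u (λ y∈xs → ∈-─ x∈ys (xs⊆ys (there y∈xs)) (λ y≡x → All.lookup x∉xs y∈xs (sym y≡x)))))
  where
  x∈ys = xs⊆ys (here refl)

HasCard-unique : ∀ {P k k′} → HasCard P k → HasCard P k′ → k ≡ k′
HasCard-unique (xs , xs-unique , xs⇔ , refl) (ys , ys-unique , ys⇔ , refl) =
  ℕₚ.≤-antisym (Unique-⊆⇒length-≤ xs-unique (λ {y} → from (ys⇔ y) ∘ to (xs⇔ y)))
               (Unique-⊆⇒length-≤ ys-unique (λ {y} → from (xs⇔ y) ∘ to (ys⇔ y)))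

codes : ∀ {A B : Set} {Code : A → B → Set} {xs} → All (λ x → ∃[ c ] Code x c) xs → List B
codes []              = []
codes ((c , _) ∷ cxs) = c ∷ codes cxs

length-codes : ∀ {A B : Set} {Code : A → B → Set} {xs} (cxs : All (λ x → ∃[ c ] Code x c) xs) →
               length (codes cxs) ≡ length xs
length-codes []        = refl
length-codes (_ ∷ cxs) = cong suc (length-codes cxs)

All-codes : ∀ {A B : Set} {Code : A → B → Set} {P : B → Set} → (∀ {x c} → Code x c → P c) →
            ∀ {xs} (cxs : All (λ x → ∃[ c ] Code x c) xs) → All P (codes cxs)
All-codes code⇒P []              = []
All-codes code⇒P ((_ , k) ∷ cxs) = code⇒P k ∷ All-codes code⇒P cxs

Unique-codes : ∀ {A B : Set} {Code : A → B → Set} {_≈_ : A → A → Set} →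
               (∀ {x y c} → Code x c → Code y c → x ≈ y) →
               ∀ {xs} (cxs : All (λ x → ∃[ c ] Code x c) xs) → AllPairs (λ x y → ¬ x ≈ y) xs → Unique (codes cxs)
Unique-codes {Code = Code} {_≈_} code-injective = go
  where
  fresh : ∀ {x c ys} → Code x c → (cys : All (λ y → ∃[ d ] Code y d) ys) → All (λ y → ¬ x ≈ y) ys →
          All (c ≢_) (codes cys)
  fresh kx []              []           = []
  fresh kx ((_ , ky) ∷ cys) (x≉y ∷ x≉ys) = (λ { refl → x≉y (code-injective kx ky) }) ∷ fresh kx cys x≉ys

  go : ∀ {xs} (cxs : All (λ x → ∃[ c ] Code x c) xs) → AllPairs (λ x y → ¬ x ≈ y) xs → Unique (codes cxs)
  go []               []             = []
  go ((_ , kx) ∷ cxs) (x≉xs ∷ apart) = fresh kx cxs x≉xs ∷ go cxs apart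

infixl 25 _without_
_without_ : Subℕ → List ℕ → Subℕ
(S without xs) n = S n ∧ not (does (n ∈? xs))

Remove-cong : ∀ {S T} l → S ≐ T → Remove S l ≐ Remove T l
Remove-cong l S≐T n with n ℕ.≟ l
... | yes _ = refl
... | no  _ = S≐T n

Remove-without : ∀ S xs l → Remove (S without xs) l ≐ S without (l ∷ xs)
Remove-without S xs l n with n ℕ.≟ l
... | yes n≡l = trans (sym (∧-zeroʳ (S n))) (cong (λ b → S n ∧ not b) (sym (dec-true (n ∈? (l ∷ xs)) (here n≡l))))
... | no  n≢l = cong (λ b → S n ∧ not (b ∨ does (n ∈? xs))) (sym (dec-false (n ℕ.≟ l) n≢l))

without-⊆ : ∀ {S xs n} → n ∈ₛ S without xs → n ∈ₛ S
without-⊆ {S} {n = n} = ∧-conicalˡ (S n) _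

without-∉ : ∀ {S xs n} → n ∈ₛ S without xs → n ∉ xs
without-∉ {S} {xs} {n} n∈ n∈xs
  with () ← trans (sym (∧-zeroʳ (S n))) (subst (λ b → S n ∧ not b ≡ true) (dec-true (n ∈? xs) n∈xs) n∈)

without-∈ : ∀ {S xs n} → n ∈ₛ S → n ∉ xs → n ∈ₛ S without xs
without-∈ {S} {xs} {n} n∈S n∉xs rewrite n∈S | dec-false (n ∈? xs) n∉xs = refl

genus-without : ∀ {S gS es xs} → Unique es → All (_∈ₛ S) es → (∀ {n} → n ∈ xs → n ∈ es) →
                Genus S gS → Genus (S without xs) (gS ℕ.+ length (filter (_∈? xs) es))
genus-without {S} {gS} {es} {xs} es-unique es⊆S xs⊆es (gaps , gaps-unique , gaps⇔ , refl) =
  gaps ++ removed , ++⁺ gaps-unique (filter⁺ (_∈? xs) es-unique) disjoint ,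
  (λ n → mk⇔ (to-gap n) (from-gap n)) , length-++ gaps
  where
  removed = filter (_∈? xs) es

  disjoint : ∀ {v} → ¬ (v ∈ gaps × v ∈ removed)
  disjoint (v∈gaps , v∈removed) = to (gaps⇔ _) v∈gaps (All.lookup es⊆S (proj₁ (∈-filter⁻ (_∈? xs) {xs = es} v∈removed)))

  to-gap : ∀ n → n ∈ gaps ++ removed → Gap (S without xs) n
  to-gap n n∈ with ∈-++⁻ gaps n∈
  ... | inj₁ n∈gaps    = to (gaps⇔ n) n∈gaps ∘ without-⊆ {S} {xs}
  ... | inj₂ n∈removed = λ n∈S-xs → without-∉ {S} {xs} n∈S-xs (proj₂ (∈-filter⁻ (_∈? xs) {xs = es} n∈removed))

  from-gap : ∀ n → Gap (S without xs) n → n ∈ gaps ++ removed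
  from-gap n gap = case n ∈? xs of λ where
    (yes n∈xs) → ∈-++⁺ʳ gaps (∈-filter⁺ (_∈? xs) (xs⊆es n∈xs) n∈xs)
    (no  n∉xs) → ∈-++⁺ˡ (from (gaps⇔ n) (λ n∈S → gap (without-∈ {S} {xs} n∈S n∉xs)))

Genus-resp : ∀ {S T g} → S ≐ T → Genus S g → Genus T g
Genus-resp S≐T (gaps , gaps-unique , gaps⇔ , len) =
  gaps , gaps-unique , (λ n → mk⇔ (λ n∈ n∈T → to (gaps⇔ n) n∈ (trans (S≐T n) n∈T))
                                    (λ gap → from (gaps⇔ n) (λ n∈S → gap (trans (sym (S≐T n)) n∈S)))) , len

indicator : List ℕ → List ℕ → List Bool
indicator es xs = map (λ e → does (e ∈? xs)) es

trues-map-does : ∀ {A : Set} {P : A → Set} (P? : Decidable P) xs →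
                 trues (map (λ x → does (P? x)) xs) ≡ length (filter P? xs)
trues-map-does P? []       = refl
trues-map-does P? (x ∷ xs) with does (P? x)
... | true  = cong suc (trues-map-does P? xs)
... | false = trues-map-does P? xs

indicator-∈ : ∀ {es xs ys n} → n ∈ es → indicator es xs ≡ indicator es ys → does (n ∈? xs) ≡ does (n ∈? ys)
indicator-∈ (here refl) eq = ∷-injectiveˡ eq
indicator-∈ {xs = xs} {ys} (there n∈es) eq = indicator-∈ {xs = xs} {ys} n∈es (∷-injectiveʳ eq)

without-indicator : ∀ {S es xs ys} → (∀ {n} → n ∈ xs → n ∈ es) → (∀ {n} → n ∈ ys → n ∈ es) →
                    indicator es xs ≡ indicator es ys → S without xs ≐ S without ys
without-indicator {S} {es} {xs} {ys} xs⊆es ys⊆es eq n = cong (λ b → S n ∧ not b) (case n ∈? es of λ where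
  (yes n∈es) → indicator-∈ {es} {xs} {ys} n∈es eq
  (no  n∉es) → trans (dec-false (n ∈? xs) (n∉es ∘ xs⊆es)) (sym (dec-false (n ∈? ys) (n∉es ∘ ys⊆es))))

EffectiveGenerator-resp : ∀ {S T} → S ≐ T → ∀ m → EffectiveGenerator S m → EffectiveGenerator T m
EffectiveGenerator-resp S≐T m ((m∈S , m≢0 , irreducible) , above) =
  (trans (sym (S≐T m)) m∈S , m≢0 ,
   λ { (a , b , a∈T , b∈T , sum) → irreducible (a , b , trans (S≐T a) a∈T , trans (S≐T b) b∈T , sum) }) ,
  λ n n∉T → above n (λ n∈S → n∉T (trans (sym (S≐T n)) n∈S))

-- The last component is the invariant that carries the induction: by weakness, the
-- generator removed at each step is still an effective generator of S.
WeakDescendent⇒without : ∀ {S T} → WeakDescendent S T →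
  ∃[ xs ] (All (EffectiveGenerator S) xs × T ≐ S without xs ×
           (∀ m → EffectiveGenerator T m → EffectiveGenerator S m))
WeakDescendent⇒without {S} (here T≐S) =
  [] , [] , (λ n → trans (T≐S n) (sym (∧-identityʳ (S n)))) , EffectiveGenerator-resp T≐S
WeakDescendent⇒without {S} (step d (l , l-eff , U≐T-l , U⊆T))
  with xs , xs-eff , T≐S-xs , T⊆S ← WeakDescendent⇒without d =
  l ∷ xs , T⊆S l l-eff ∷ xs-eff ,
  (λ n → trans (U≐T-l n) (trans (Remove-cong l T≐S-xs n) (Remove-without S xs l n))) ,
  (λ m → T⊆S m ∘ U⊆T m)

module _ {S gS es} (genus-S : Genus S gS) (es-unique : Unique es)
         (es⇔ : ∀ n → (n ∈ es) ⇔ EffectiveGenerator S n) where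

  -- A weak descendent T is encoded by the indicator word of the effective generators removed from S.
  Code : Subℕ → List Bool → Set
  Code T b = ∃[ xs ] ((∀ {n} → n ∈ xs → n ∈ es) × T ≐ S without xs × indicator es xs ≡ b)

  Code-injective : ∀ {T U b} → Code T b → Code U b → T ≐ U
  Code-injective (xs , xs⊆es , T≐ , refl) (ys , ys⊆es , U≐ , eq) n =
    trans (T≐ n) (trans (without-indicator {S} xs⊆es ys⊆es (sym eq) n) (sym (U≐ n)))

  descendent-code : ∀ {T g} → WeakDescendent S T → Genus T g →
                    ∃[ b ] (Code T b × length b ≡ length es × g ≡ gS ℕ.+ trues b)
  descendent-code {g = g} d genus-T with xs , xs-eff , T≐ , _ ← WeakDescendent⇒without d =
    indicator es xs , (xs , xs⊆es , T≐ , refl) , length-map _ es , genus-T≡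
    where
    xs⊆es : ∀ {n} → n ∈ xs → n ∈ es
    xs⊆es n∈xs = from (es⇔ _) (All.lookup xs-eff n∈xs)

    es⊆S : All (_∈ₛ S) es
    es⊆S = All.tabulate (λ e∈es → proj₁ (proj₁ (to (es⇔ _) e∈es)))

    genus-T≡ : g ≡ gS ℕ.+ trues (indicator es xs)
    genus-T≡ = begin
      g                                     ≡⟨ HasCard-unique genus-T
                                                 (Genus-resp (sym ∘ T≐) (genus-without es-unique es⊆S xs⊆es genus-S)) ⟩
      gS ℕ.+ length (filter (_∈? xs) es)    ≡⟨ cong (gS ℕ.+_) (trues-map-does (_∈? xs) es) ⟨
      gS ℕ.+ trues (indicator es xs)        ∎
      where open ≡-Reasoning

  descendents-≤C : ∀ {k Ts} → All (λ T → WeakDescendent S T × Genus T (gS ℕ.+ k)) Ts →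
                   AllPairs (λ T U → ¬ T ≐ U) Ts → length Ts ≤ length es C k
  descendents-≤C {k} descs apart =
    subst (_≤ length es C k) (length-codes cxs)
      (Unique-HasWeight-≤C (length es) k (All-codes proj₂ cxs)
        (Unique-codes (λ c c′ → Code-injective (proj₁ c) (proj₁ c′)) cxs apart))
    where
    weighted-code : ∀ {T} → WeakDescendent S T × Genus T (gS ℕ.+ k) → ∃[ b ] (Code T b × HasWeight (length es) k b)
    weighted-code (d , genus-T) with b , code , len , genus≡ ← descendent-code d genus-T =
      b , code , len , ℕₚ.+-cancelˡ-≡ gS _ _ (sym genus≡)

    cxs = All.map weighted-code descs

+[m+n]-+m≡+n : ∀ m n → + (m ℕ.+ n) - + m ≡ + n
+[m+n]-+m≡+n m n = begin
  + (m ℕ.+ n) - + m     ≡⟨ ℤₚ.m-n≡m⊖n (m ℕ.+ n) m ⟩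
  (m ℕ.+ n) ⊖ m         ≡⟨ ℤₚ.⊖-≥ (ℕₚ.m≤m+n m n) ⟩
  + (m ℕ.+ n ∸ m)       ≡⟨ cong +_ (ℕₚ.m+n∸m≡n m n) ⟩
  + n                   ∎
  where open ≡-Reasoning

binomial-and-φ-bounds : ∀ {c h gS k} → c ≤ h C k →
  (c ≤ binomℤ h (+ (gS ℕ.+ k) - + gS)) × (ℕ→ℤφ c ≤φ φ^ ((+ (gS ℕ.+ k) - + gS) + + h))
binomial-and-φ-bounds {c} {h} {gS} {k} c≤C rewrite +[m+n]-+m≡+n gS k =
  c≤C , ≤φ-pow (k ℕ.+ h) (ℕₚ.≤-trans c≤C (C≤fib h k))

lemma2 : (S : Subℕ) → IsNumericalSemigroup S →
         (gS h : ℕ) → Genus S gS → HasCard (EffectiveGenerator S) h →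
         (g : ℕ) → (Ts : List Subℕ) → DistinctWeakDescendentsOfGenus S g Ts →
         (length Ts ≤ binomℤ h (+ g - + gS))
         × (ℕ→ℤφ (length Ts) ≤φ φ^ ((+ g - + gS) + + h))
lemma2 S _ gS h genus-S (es , es-unique , es⇔ , refl) g [] _ = z≤n , nonNeg⇒0≤φ (nonNeg-φ^ ((+ g - + gS) + + length es))
lemma2 S _ gS h genus-S (es , es-unique , es⇔ , refl) g (_ ∷ _) (descs@((d , genus-T) ∷ _) , apart)
  with b , _ , _ , refl ← descendent-code genus-S es-unique es⇔ d genus-T =
  binomial-and-φ-bounds {gS = gS} {k = trues b} (descendents-≤C genus-S es-unique es⇔ descs apart)
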